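{- Let $H$ be a graph with $V(H)=\{x,y,u,v,a,b,c,d\}$ and $E(H_5)\subseteq E(H)\subseteq E(H_2)$. Let $t$ be the number of edges of $H$ lying in $\{\{a,b\},\{b,d\},\{d,c\},\{c,a\}\}$. If $t\in\{1,2,3\}$, then either $H$ contains an induced $4$-cycle or $H$ is isomorphic to $H_6$.
   Context: $H_5$ is the graph on $\{x,y,u,v,a,b,c,d\}$ with edges $xa,au,uc,cy,yd,dv,vb,bx,ad$. $H_2$ is the graph on the same vertex set with edges $xa,au,uc,cy,yd,dv,vb,bx,ab,ac,ad,bd,cd,bc$. $H_6$ is the graph on the same vertex set with edges $xa,au,uc,cy,yd,dv,vb,bx,ac,ad,cd$. -}

module Defs where

open import Data.Bool using (Bool; true; false)
open import Data.Nat using (ℕ; _+_)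
open import Data.Product using (Σ; _×_; ∃-syntax)
open import Relation.Binary.PropositionalEquality using (_≡_)
open import Relation.Nullary using (¬_)
open import Function.Bundles using (_↔_; Inverse)

data V : Set where
  x y u v a b c d : V

record Graph : Set where
  field
    adj    : V → V → Bool
    sym    : ∀ p q → adj p q ≡ adj q p
    irrefl : ∀ p → adj p p ≡ false
open Graph public

H5adj : V → V → Bool
H5adj x a = true
H5adj a x = true
H5adj a u = true
H5adj u a = true
H5adj u c = true
H5adj c u = true
H5adj c y = true
H5adj y c = true
H5adj y d = true
H5adj d y = true
H5adj d v = true
H5adj v d = true
H5adj v b = true
H5adj b v = true
H5adj b x = true
H5adj x b = true
H5adj a d = true
H5adj d a = true
H5adj _ _ = false

H2adj : V → V → Bool
H2adj x a = true
H2adj a x = true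
H2adj a u = true
H2adj u a = true
H2adj u c = true
H2adj c u = true
H2adj c y = true
H2adj y c = true
H2adj y d = true
H2adj d y = true
H2adj d v = true
H2adj v d = true
H2adj v b = true
H2adj b v = true
H2adj b x = true
H2adj x b = true
H2adj a b = true
H2adj b a = true
H2adj a c = true
H2adj c a = true
H2adj a d = true
H2adj d a = true
H2adj b d = true
H2adj d b = true
H2adj c d = true
H2adj d c = true
H2adj b c = true
H2adj c b = true
H2adj _ _ = false

H6adj : V → V → Bool
H6adj x a = true
H6adj a x = true
H6adj a u = true
H6adj u a = true
H6adj u c = true
H6adj c u = true
H6adj c y = true
H6adj y c = true
H6adj y d = true
H6adj d y = true
H6adj d v = true
H6adj v d = true
H6adj v b = true
H6adj b v = true
H6adj b x = true
H6adj x b = true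
H6adj a c = true
H6adj c a = true
H6adj a d = true
H6adj d a = true
H6adj c d = true
H6adj d c = true
H6adj _ _ = false

_⊆E_ : (V → V → Bool) → (V → V → Bool) → Set
A ⊆E B = ∀ p q → A p q ≡ true → B p q ≡ true

b2n : Bool → ℕ
b2n true  = 1
b2n false = 0

tCount : Graph → ℕ
tCount H = b2n (adj H a b) + b2n (adj H b d) + b2n (adj H d c) + b2n (adj H c a)

HasInducedC4 : Graph → Set
HasInducedC4 H = ∃[ w1 ] ∃[ w2 ] ∃[ w3 ] ∃[ w4 ]
  ( (¬ w1 ≡ w2) × (¬ w1 ≡ w3) × (¬ w1 ≡ w4) × (¬ w2 ≡ w3) × (¬ w2 ≡ w4) × (¬ w3 ≡ w4)
  × adj H w1 w2 ≡ true × adj H w2 w3 ≡ true × adj H w3 w4 ≡ true × adj H w4 w1 ≡ true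
  × adj H w1 w3 ≡ false × adj H w2 w4 ≡ false )

IsoToH6 : Graph → Set
IsoToH6 H = Σ (V ↔ V) λ f →
  ∀ p q → adj H (Inverse.to f p) (Inverse.to f q) ≡ H6adj p q

-- Every H with H5 ⊆ H ⊆ H2 is H5 plus some of the five chords ab, bd, dc, ca, bc.
-- If exactly one of ab, bd is present, then x a d b or v b a d is an induced
-- 4-cycle; likewise for dc, ca with u a d c or y c a d.  Otherwise ab = bd and
-- dc = ca, and t ∈ {1,2,3} forces exactly one of these pairs to be present.
-- Then either the chord bc closes an induced 4-cycle (y c b d, resp. x a c b),
-- or H is the image of H6 under the reflection x↔y, u↔v, a↔d, b↔c, resp. H6 itself.
module Submission where

open import Defs hiding (sym)
open import Data.Bool using (Bool; true; false)
open import Data.Bool.Properties using () renaming (_≟_ to _≟ᵇ_)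
open import Data.List using (List; []; _∷_)
open import Data.List.Membership.Propositional using (_∈_)
open import Data.List.Relation.Unary.All using (all?; lookup)
open import Data.List.Relation.Unary.Any using (here; there)
open import Data.Nat using (_≤_; s≤s; _+_)
open import Data.Product using (Σ; _×_; _,_; ∃-syntax)
open import Data.Sum using (_⊎_; inj₁; inj₂; map)
open import Function.Base using (_on_)
open import Function.Bundles using (_↔_; Inverse; mk↔ₛ′)
open import Function.Construct.Identity using (↔-id)
open import Relation.Binary.PropositionalEquality using (_≡_; refl; sym; trans)
open import Relation.Nullary using (¬_)
open import Relation.Nullary.Decidable using (True; toWitness)

Adj : Set
Adj = V → V → Bool

_≐_ : Adj → Adj → Set
g ≐ h = ∀ p q → g p q ≡ h p q

≐-sym : ∀ {g h} → g ≐ h → h ≐ g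
≐-sym g≐h p q = sym (g≐h p q)

vertices : List V
vertices = x ∷ y ∷ u ∷ v ∷ a ∷ b ∷ c ∷ d ∷ []

∈-vertices : ∀ p → p ∈ vertices
∈-vertices x = here refl
∈-vertices y = there (here refl)
∈-vertices u = there (there (here refl))
∈-vertices v = there (there (there (here refl)))
∈-vertices a = there (there (there (there (here refl))))
∈-vertices b = there (there (there (there (there (here refl)))))
∈-vertices c = there (there (there (there (there (there (here refl))))))
∈-vertices d = there (there (there (there (there (there (there (here refl)))))))

≐-by-computation : (g h : Adj) →
  {_ : True (all? (λ p → all? (λ q → g p q ≟ᵇ h p q) vertices) vertices)} → g ≐ h
≐-by-computation g h {agree} p q =
  lookup (lookup (toWitness agree) (∈-vertices p)) (∈-vertices q)

InducedC4 : Adj → Set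
InducedC4 g = ∃[ w1 ] ∃[ w2 ] ∃[ w3 ] ∃[ w4 ]
  ( (¬ w1 ≡ w2) × (¬ w1 ≡ w3) × (¬ w1 ≡ w4) × (¬ w2 ≡ w3) × (¬ w2 ≡ w4) × (¬ w3 ≡ w4)
  × g w1 w2 ≡ true × g w2 w3 ≡ true × g w3 w4 ≡ true × g w4 w1 ≡ true
  × g w1 w3 ≡ false × g w2 w4 ≡ false )

IsomorphicToH6 : Adj → Set
IsomorphicToH6 g = Σ (V ↔ V) λ f → ∀ p q → g (Inverse.to f p) (Inverse.to f q) ≡ H6adj p q

InducedC4-resp : ∀ {g h} → g ≐ h → InducedC4 g → InducedC4 h
InducedC4-resp {g} {h} g≐h (w1 , w2 , w3 , w4 , n12 , n13 , n14 , n23 , n24 , n34 ,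
                            e12 , e23 , e34 , e41 , f13 , f24) =
  w1 , w2 , w3 , w4 , n12 , n13 , n14 , n23 , n24 , n34 ,
  moved w1 w2 e12 , moved w2 w3 e23 , moved w3 w4 e34 , moved w4 w1 e41 ,
  moved w1 w3 f13 , moved w2 w4 f24
  where
  moved : ∀ p q {β} → g p q ≡ β → h p q ≡ β
  moved p q = trans (≐-sym g≐h p q)

IsomorphicToH6-resp : ∀ {g h} → g ≐ h → IsomorphicToH6 g → IsomorphicToH6 h
IsomorphicToH6-resp g≐h (f , f-iso) = f , λ p q → trans (≐-sym g≐h _ _) (f-iso p q)

H5-plus : (ab bd dc ca bc : Bool) → Adj
H5-plus ab bd dc ca bc a b = ab
H5-plus ab bd dc ca bc b a = ab
H5-plus ab bd dc ca bc b d = bd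
H5-plus ab bd dc ca bc d b = bd
H5-plus ab bd dc ca bc d c = dc
H5-plus ab bd dc ca bc c d = dc
H5-plus ab bd dc ca bc c a = ca
H5-plus ab bd dc ca bc a c = ca
H5-plus ab bd dc ca bc b c = bc
H5-plus ab bd dc ca bc c b = bc
H5-plus ab bd dc ca bc p q = H5adj p q

module _ (H : Graph) (H5⊆H : H5adj ⊆E adj H) (H⊆H2 : adj H ⊆E H2adj) where

  adj-squeezed : ∀ {p q} {_ : True (H5adj p q ≟ᵇ H2adj p q)} → adj H p q ≡ H5adj p q
  adj-squeezed {p} {q} {agree} with H5adj p q in H5pq | adj H p q in Hpq | toWitness agree
  ... | true  | _     | _     = trans (sym Hpq) (H5⊆H p q H5pq)
  ... | false | false | _     = refl
  ... | false | true  | H5≡H2 = trans (sym (H⊆H2 p q Hpq)) (sym H5≡H2)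

  adj≐H5-plus : adj H ≐ H5-plus (adj H a b) (adj H b d) (adj H d c) (adj H c a) (adj H b c)
  adj≐H5-plus x = λ { x → adj-squeezed ; y → adj-squeezed ; u → adj-squeezed ; v → adj-squeezed
                    ; a → adj-squeezed ; b → adj-squeezed ; c → adj-squeezed ; d → adj-squeezed }
  adj≐H5-plus y = λ { x → adj-squeezed ; y → adj-squeezed ; u → adj-squeezed ; v → adj-squeezed
                    ; a → adj-squeezed ; b → adj-squeezed ; c → adj-squeezed ; d → adj-squeezed }
  adj≐H5-plus u = λ { x → adj-squeezed ; y → adj-squeezed ; u → adj-squeezed ; v → adj-squeezed
                    ; a → adj-squeezed ; b → adj-squeezed ; c → adj-squeezed ; d → adj-squeezed }
  adj≐H5-plus v = λ { x → adj-squeezed ; y → adj-squeezed ; u → adj-squeezed ; v → adj-squeezed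
                    ; a → adj-squeezed ; b → adj-squeezed ; c → adj-squeezed ; d → adj-squeezed }
  adj≐H5-plus a = λ { x → adj-squeezed ; y → adj-squeezed ; u → adj-squeezed ; v → adj-squeezed
                    ; a → adj-squeezed ; b → refl ; c → Graph.sym H a c ; d → adj-squeezed }
  adj≐H5-plus b = λ { x → adj-squeezed ; y → adj-squeezed ; u → adj-squeezed ; v → adj-squeezed
                    ; a → Graph.sym H b a ; b → adj-squeezed ; c → refl ; d → refl }
  adj≐H5-plus c = λ { x → adj-squeezed ; y → adj-squeezed ; u → adj-squeezed ; v → adj-squeezed
                    ; a → refl ; b → Graph.sym H c b ; c → adj-squeezed ; d → Graph.sym H c d }
  adj≐H5-plus d = λ { x → adj-squeezed ; y → adj-squeezed ; u → adj-squeezed ; v → adj-squeezed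
                    ; a → adj-squeezed ; b → Graph.sym H d b ; c → refl ; d → adj-squeezed }

reflect : V → V
reflect x = y
reflect y = x
reflect u = v
reflect v = u
reflect a = d
reflect b = c
reflect c = b
reflect d = a

reflect-involutive : ∀ p → reflect (reflect p) ≡ p
reflect-involutive x = refl
reflect-involutive y = refl
reflect-involutive u = refl
reflect-involutive v = refl
reflect-involutive a = refl
reflect-involutive b = refl
reflect-involutive c = refl
reflect-involutive d = refl

reflect↔ : V ↔ V
reflect↔ = mk↔ₛ′ reflect reflect reflect-involutive reflect-involutive

H5-plus-dichotomy : ∀ ab bd dc ca bc →
  1 ≤ b2n ab + b2n bd + b2n dc + b2n ca → b2n ab + b2n bd + b2n dc + b2n ca ≤ 3 →
  InducedC4 (H5-plus ab bd dc ca bc) ⊎ IsomorphicToH6 (H5-plus ab bd dc ca bc)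
H5-plus-dichotomy false true  _     _     _     _ _ =
  inj₁ (x , a , d , b , (λ ()) , (λ ()) , (λ ()) , (λ ()) , (λ ()) , (λ ()) , refl , refl , refl , refl , refl , refl)
H5-plus-dichotomy true  false _     _     _     _ _ =
  inj₁ (v , b , a , d , (λ ()) , (λ ()) , (λ ()) , (λ ()) , (λ ()) , (λ ()) , refl , refl , refl , refl , refl , refl)
H5-plus-dichotomy _     _     true  false _     _ _ =
  inj₁ (u , a , d , c , (λ ()) , (λ ()) , (λ ()) , (λ ()) , (λ ()) , (λ ()) , refl , refl , refl , refl , refl , refl)
H5-plus-dichotomy _     _     false true  _     _ _ =
  inj₁ (y , c , a , d , (λ ()) , (λ ()) , (λ ()) , (λ ()) , (λ ()) , (λ ()) , refl , refl , refl , refl , refl , refl)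
H5-plus-dichotomy true  true  false false true  _ _ =
  inj₁ (y , c , b , d , (λ ()) , (λ ()) , (λ ()) , (λ ()) , (λ ()) , (λ ()) , refl , refl , refl , refl , refl , refl)
H5-plus-dichotomy true  true  false false false _ _ =
  inj₂ (reflect↔ , ≐-by-computation (H5-plus true true false false false on reflect) H6adj)
H5-plus-dichotomy false false true  true  true  _ _ =
  inj₁ (x , a , c , b , (λ ()) , (λ ()) , (λ ()) , (λ ()) , (λ ()) , (λ ()) , refl , refl , refl , refl , refl , refl)
H5-plus-dichotomy false false true  true  false _ _ =
  inj₂ (↔-id V , ≐-by-computation (H5-plus false false true true false) H6adj)
H5-plus-dichotomy true  true  true  true  _     _ (s≤s (s≤s (s≤s ())))
H5-plus-dichotomy false false false false _     () _

lemma4p6 : (H : Graph) → H5adj ⊆E adj H → adj H ⊆E H2adj →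
    1 ≤ tCount H × tCount H ≤ 3 →
    HasInducedC4 H ⊎ IsoToH6 H
lemma4p6 H H5⊆H H⊆H2 (1≤t , t≤3) =
  map (InducedC4-resp H5-plus≐adj) (IsomorphicToH6-resp H5-plus≐adj)
      (H5-plus-dichotomy _ _ _ _ _ 1≤t t≤3)
  where
  H5-plus≐adj : H5-plus (adj H a b) (adj H b d) (adj H d c) (adj H c a) (adj H b c) ≐ adj H
  H5-plus≐adj = ≐-sym (adj≐H5-plus H H5⊆H H⊆H2)
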